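{- Let $A$ be a distributed MALL formula and let $\pi$ be a proof with $\pi\equiv\mathrm{id}_A$. Then: (i) every $\top$-rule of $\pi$ has conclusion exactly $\vdash\top,0$, where the $\top$ occurrence is in $A$ and the $0$ occurrence is its dual occurrence in $A^\perp$, or vice versa; (ii) the $\bot$-rules and $1$-rules of $\pi$ come in pairs, each pair forming a $1/\oplus/\bot$-pattern: a $1$-rule with conclusion $\vdash1$, followed by a (possibly empty) sequence of $\oplus_1$/$\oplus_2$-rules yielding $\vdash F$, followed by a $\bot$-rule with conclusion $\vdash\bot,F$, where the $\bot$ occurrence is in $A$ and the $1$ is its dual occurrence in $A^\perp$, or vice versa; (iii) no sequent of $\pi$ is of the shape $\vdash B\&C$ (a single formula whose main connective is $\&$).
   Context: MALL formulas with De Morgan negation ($(A\otimes B)^\perp=B^\perp⅋A^\perp$, $(A\&B)^\perp=B^\perp\oplus A^\perp$, $1^\perp=\bot$, $\top^\perp=0$). The syntactic tree of $A^\perp$ mirrors that of $A$; each occurrence (vertex) $V$ of $A$ has a dual occurrence $V^\perp$ in $A^\perp$. $\mathrm{id}_A$ is the cut-free proof of $\vdash A^\perp,A$ obtained by fully axiom-expanding the single axiom on $A$ (axiom on $A\otimes B$ becomes $⅋$ of $\otimes$ of axioms on $A$, $B$; axiom on $A\oplus B$ becomes $\&$ of $\oplus_2$ of axiom on $B$ and $\oplus_1$ of axiom on $A$; axiom on $1,\bot$ becomes $\bot$ of $1$; axiom on $0,\top$ becomes a $\top$-rule). Rule commutation $\equiv$ is the reflexive transitive closure of one-step commutation: exchanging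 two consecutive non-$ax$, non-$cut$ MALL rules acting on distinct formulas per the standard permutation table (duplicating across $\&$, creating/erasing across $\top$, swapping principal $\top$ among two, swapping two $\bot$'s), allowed only with no cut above. A formula is distributed if it has no subformula of the forms $A\otimes(B\oplus C)$, $(A\oplus B)\otimes C$, $A\otimes1$, $1\otimes A$, $A\oplus0$, $0\oplus A$, $A\otimes0$, $0\otimes A$, $(C\&B)⅋A$, $C⅋(B\&A)$, $\bot⅋A$, $A⅋\bot$, $\top\&A$, $A\&\top$, $\top⅋A$, $A⅋\top$. -}

module Defs where

open import Data.Nat using (ℕ)
open import Data.List using (List; []; _∷_; _++_; map)
open import Data.Product using (Σ; _×_; _,_; proj₁; proj₂)
open import Relation.Nullary using (¬_)
open import Relation.Binary.PropositionalEquality using (_≡_)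
open import Relation.Binary.Construct.Closure.ReflexiveTransitive using (Star)
open import Data.List.Relation.Binary.Permutation.Propositional
  using (_↭_; refl; prep; swap; trans)

infixr 6 _⊗_ _⅋_
infixr 5 _⊕_ _&_
infix 9 _^⊥

data Formula : Set where
  atom natom : ℕ → Formula
  _⊗_ _⅋_ _⊕_ _&_ : Formula → Formula → Formula
  𝟙 ⊥ₗ 𝟘 ⊤ₗ : Formula

_^⊥ : Formula → Formula
atom n ^⊥ = natom n
natom n ^⊥ = atom n
(A ⊗ B) ^⊥ = B ^⊥ ⅋ A ^⊥
(A ⅋ B) ^⊥ = B ^⊥ ⊗ A ^⊥
(A ⊕ B) ^⊥ = B ^⊥ & A ^⊥
(A & B) ^⊥ = B ^⊥ ⊕ A ^⊥
𝟙 ^⊥ = ⊥ₗ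
⊥ₗ ^⊥ = 𝟙
𝟘 ^⊥ = ⊤ₗ
⊤ₗ ^⊥ = 𝟘

-- An occurrence (vertex) of A or of A^⊥ is given by its
-- side (inside A^⊥ or inside A) and its path from the root (most recent
-- step first); lft/rgt = left/right immediate subformula.
-- The tree of A^⊥ mirrors that of A, so the dual occurrence flips the
-- side and mirrors every step of the path.

data Side : Set where
  inA⊥ inA : Side

data Dir : Set where
  lft rgt : Dir

Addr : Set
Addr = Side × List Dir

flipS : Side → Side
flipS inA⊥ = inA
flipS inA = inA⊥

flipD : Dir → Dir
flipD lft = rgt
flipD rgt = lft

dualᵃ : Addr → Addr
dualᵃ a = flipS (proj₁ a) , map flipD (proj₂ a)

_◂_ : Addr → Dir → Addr
a ◂ d = proj₁ a , d ∷ proj₂ a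

-- located formula = formula occurrence; sequents are lists of these,
-- considered up to permutation (_↭_).
LF : Set
LF = Formula × Addr

Seq : Set
Seq = List LF

Unary : Seq → LF → List LF → Seq → Set
Unary Γ P As Θ = Σ Seq λ Δ → (Γ ↭ P ∷ Δ) × (Θ ↭ As ++ Δ)

Split : Seq → LF → LF → Seq → LF → Seq → Set
Split Γ P X Θ₁ Y Θ₂ = Σ Seq λ Δ₁ → Σ Seq λ Δ₂ →
  (Γ ↭ P ∷ Δ₁ ++ Δ₂) × (Θ₁ ↭ X ∷ Δ₁) × (Θ₂ ↭ Y ∷ Δ₂)

Share : Seq → LF → LF → Seq → LF → Seq → Set
Share Γ P X Θ₁ Y Θ₂ = Σ Seq λ Δ →
  (Γ ↭ P ∷ Δ) × (Θ₁ ↭ X ∷ Δ) × (Θ₂ ↭ Y ∷ Δ)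

TopW : Seq → Addr → Set
TopW Γ a = Σ Seq λ Δ → Γ ↭ (⊤ₗ , a) ∷ Δ

data UData : Set where
  bot : Addr → UData
  par plus1 plus2 : Formula → Formula → Addr → UData

principal : UData → LF
principal (bot a) = ⊥ₗ , a
principal (par A B a) = A ⅋ B , a
principal (plus1 A B a) = A ⊕ B , a
principal (plus2 A B a) = A ⊕ B , a

actives : UData → List LF
actives (bot a) = []
actives (par A B a) = (A , a ◂ lft) ∷ (B , a ◂ rgt) ∷ []
actives (plus1 A B a) = (A , a ◂ lft) ∷ []
actives (plus2 A B a) = (B , a ◂ rgt) ∷ []

data Proof : Seq → Set where
  ax     : ∀ {Γ} (A : Formula) (a b : Addr) →
           Γ ↭ (A ^⊥ , a) ∷ (A , b) ∷ [] → Proof Γ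
  one    : ∀ {Γ} (a : Addr) → Γ ↭ (𝟙 , a) ∷ [] → Proof Γ
  top    : ∀ {Γ} (a : Addr) → TopW Γ a → Proof Γ
  unary  : ∀ {Γ Θ} (d : UData) → Unary Γ (principal d) (actives d) Θ →
           Proof Θ → Proof Γ
  tensor : ∀ {Γ Θ₁ Θ₂} (A B : Formula) (a : Addr) →
           Split Γ (A ⊗ B , a) (A , a ◂ lft) Θ₁ (B , a ◂ rgt) Θ₂ →
           Proof Θ₁ → Proof Θ₂ → Proof Γ
  amp    : ∀ {Γ Θ₁ Θ₂} (A B : Formula) (a : Addr) →
           Share Γ (A & B , a) (A , a ◂ lft) Θ₁ (B , a ◂ rgt) Θ₂ →
           Proof Θ₁ → Proof Θ₂ → Proof Γ

private
  swap2 : ∀ (x y : LF) → x ∷ y ∷ [] ↭ y ∷ x ∷ []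
  swap2 x y = swap x y refl

  rev3 : ∀ (x y z : LF) → x ∷ y ∷ z ∷ [] ↭ z ∷ y ∷ x ∷ []
  rev3 x y z = trans (swap x y refl) (trans (prep y (swap x z refl)) (swap y z refl))

idp : (A : Formula) (a : Addr) → Proof ((A ^⊥ , dualᵃ a) ∷ (A , a) ∷ [])
idp (atom n) a = ax (atom n) (dualᵃ a) a refl
idp (natom n) a = ax (natom n) (dualᵃ a) a refl
idp (A ⊗ B) a =
  unary (par (B ^⊥) (A ^⊥) (dualᵃ a)) ((A ⊗ B , a) ∷ [] , refl , refl)
    (tensor A B a
      ((A ^⊥ , dualᵃ a ◂ rgt) ∷ [] , (B ^⊥ , dualᵃ a ◂ lft) ∷ [] ,
        rev3 _ _ _ , swap2 _ _ , swap2 _ _)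
      (idp A (a ◂ lft)) (idp B (a ◂ rgt)))
idp (A ⅋ B) a =
  unary (par A B a) ((B ^⊥ ⊗ A ^⊥ , dualᵃ a) ∷ [] , swap2 _ _ , refl)
    (tensor (B ^⊥) (A ^⊥) (dualᵃ a)
      ((B , a ◂ rgt) ∷ [] , (A , a ◂ lft) ∷ [] , rev3 _ _ _ , refl , refl)
      (idp B (a ◂ rgt)) (idp A (a ◂ lft)))
idp (A ⊕ B) a =
  amp (B ^⊥) (A ^⊥) (dualᵃ a) ((A ⊕ B , a) ∷ [] , refl , refl , refl)
    (unary (plus2 A B a) ((B ^⊥ , dualᵃ a ◂ lft) ∷ [] , swap2 _ _ , swap2 _ _)
      (idp B (a ◂ rgt)))
    (unary (plus1 A B a) ((A ^⊥ , dualᵃ a ◂ rgt) ∷ [] , swap2 _ _ , swap2 _ _)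
      (idp A (a ◂ lft)))
idp (A & B) a =
  amp A B a ((B ^⊥ ⊕ A ^⊥ , dualᵃ a) ∷ [] , swap2 _ _ , refl , refl)
    (unary (plus2 (B ^⊥) (A ^⊥) (dualᵃ a)) ((A , a ◂ lft) ∷ [] , swap2 _ _ , refl)
      (idp A (a ◂ lft)))
    (unary (plus1 (B ^⊥) (A ^⊥) (dualᵃ a)) ((B , a ◂ rgt) ∷ [] , swap2 _ _ , refl)
      (idp B (a ◂ rgt)))
idp 𝟙 a = unary (bot (dualᵃ a)) ((𝟙 , a) ∷ [] , refl , refl) (one a refl)
idp ⊥ₗ a = unary (bot a) ((𝟙 , dualᵃ a) ∷ [] , swap2 _ _ , refl) (one (dualᵃ a) refl)
idp 𝟘 a = top (dualᵃ a) ((𝟘 , a) ∷ [] , refl)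
idp ⊤ₗ a = top a ((𝟘 , dualᵃ a) ∷ [] , swap2 _ _)

idProof : (A : Formula) → Proof ((A ^⊥ , (inA⊥ , [])) ∷ (A , (inA , [])) ∷ [])
idProof A = idp A (inA , [])

-- One-step rule commutation (root cases of the permutation table, with
-- arbitrary exchange witnesses, plus closure under contexts).
-- Lower rule written first; the table is then closed under symmetry below.

infix 4 _⇝_
data _⇝_ : ∀ {Γ} → Proof Γ → Proof Γ → Set where
  uu : ∀ {Γ Θ Θ' Ξ} (d e : UData) {w₁ w₂ w₃ w₄} {π : Proof Ξ} →
       unary {Γ} {Θ} d w₁ (unary e w₂ π) ⇝ unary {Γ} {Θ'} e w₃ (unary d w₄ π)
  u⊗ₗ : ∀ {Γ Θ Θ₁ Θ₂ Θ₁'} d A B a {w₁ w₂ w₃ w₄} {π₁ : Proof Θ₁} {π₂ : Proof Θ₂} →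
       unary {Γ} {Θ} d w₁ (tensor A B a w₂ π₁ π₂) ⇝
       tensor {Γ} {Θ₁'} A B a w₃ (unary d w₄ π₁) π₂
  u⊗ᵣ : ∀ {Γ Θ Θ₁ Θ₂ Θ₂'} d A B a {w₁ w₂ w₃ w₄} {π₁ : Proof Θ₁} {π₂ : Proof Θ₂} →
       unary {Γ} {Θ} d w₁ (tensor A B a w₂ π₁ π₂) ⇝
       tensor {Γ} {_} {Θ₂'} A B a w₃ π₁ (unary d w₄ π₂)
  u& : ∀ {Γ Θ Θ₁ Θ₂ Θ₁' Θ₂'} d A B a {w₁ w₂ w₃ w₄ w₅} {π₁ : Proof Θ₁} {π₂ : Proof Θ₂} →
       unary {Γ} {Θ} d w₁ (amp A B a w₂ π₁ π₂) ⇝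
       amp {Γ} {Θ₁'} {Θ₂'} A B a w₃ (unary d w₄ π₁) (unary d w₅ π₂)
  ⊗⊗₁ : ∀ {Γ X Y Θ₁ Θ₂ X'} A B a C D c {w₁ w₂ w₃ w₄}
          {π₁ : Proof Θ₁} {π₂ : Proof Θ₂} {ρ : Proof Y} →
       tensor {Γ} {X} A B a w₁ (tensor C D c w₂ π₁ π₂) ρ ⇝
       tensor {Γ} {X'} C D c w₃ (tensor A B a w₄ π₁ ρ) π₂
  ⊗⊗₂ : ∀ {Γ X Y Θ₁ Θ₂ X'} A B a C D c {w₁ w₂ w₃ w₄}
          {π₁ : Proof Θ₁} {π₂ : Proof Θ₂} {ρ : Proof Y} →
       tensor {Γ} {X} A B a w₁ (tensor C D c w₂ π₁ π₂) ρ ⇝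
       tensor {Γ} {_} {X'} C D c w₃ π₁ (tensor A B a w₄ π₂ ρ)
  ⊗⊗₃ : ∀ {Γ X Y Θ₁ Θ₂ Y'} A B a C D c {w₁ w₂ w₃ w₄}
          {π₁ : Proof Θ₁} {π₂ : Proof Θ₂} {ρ : Proof X} →
       tensor {Γ} {X} {Y} A B a w₁ ρ (tensor C D c w₂ π₁ π₂) ⇝
       tensor {Γ} {Y'} C D c w₃ (tensor A B a w₄ ρ π₁) π₂
  ⊗⊗₄ : ∀ {Γ X Y Θ₁ Θ₂ Y'} A B a C D c {w₁ w₂ w₃ w₄}
          {π₁ : Proof Θ₁} {π₂ : Proof Θ₂} {ρ : Proof X} →
       tensor {Γ} {X} {Y} A B a w₁ ρ (tensor C D c w₂ π₁ π₂) ⇝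
       tensor {Γ} {_} {Y'} C D c w₃ π₁ (tensor A B a w₄ ρ π₂)
  ⊗&₁ : ∀ {Γ X Y Θ₁ Θ₂ Z₁ Z₂} A B a C D c {w₁ w₂ w₃ w₄ w₅}
          {π₁ : Proof Θ₁} {π₂ : Proof Θ₂} {ρ : Proof Y} →
       tensor {Γ} {X} A B a w₁ (amp C D c w₂ π₁ π₂) ρ ⇝
       amp {Γ} {Z₁} {Z₂} C D c w₃ (tensor A B a w₄ π₁ ρ) (tensor A B a w₅ π₂ ρ)
  ⊗&₂ : ∀ {Γ X Y Θ₁ Θ₂ Z₁ Z₂} A B a C D c {w₁ w₂ w₃ w₄ w₅}
          {π₁ : Proof Θ₁} {π₂ : Proof Θ₂} {ρ : Proof X} →
       tensor {Γ} {X} {Y} A B a w₁ ρ (amp C D c w₂ π₁ π₂) ⇝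
       amp {Γ} {Z₁} {Z₂} C D c w₃ (tensor A B a w₄ ρ π₁) (tensor A B a w₅ ρ π₂)
  && : ∀ {Γ X Y Θ₁₁ Θ₁₂ Θ₂₁ Θ₂₂ X' Y'} A B a C D c {w₁ w₂ w₃ w₄ w₅ w₆}
          {π₁₁ : Proof Θ₁₁} {π₁₂ : Proof Θ₁₂} {π₂₁ : Proof Θ₂₁} {π₂₂ : Proof Θ₂₂} →
       amp {Γ} {X} {Y} A B a w₁ (amp C D c w₂ π₁₁ π₁₂) (amp C D c w₃ π₂₁ π₂₂) ⇝
       amp {Γ} {X'} {Y'} C D c w₄ (amp A B a w₅ π₁₁ π₂₁) (amp A B a w₆ π₁₂ π₂₂)
  u⊤ : ∀ {Γ Θ} d a {w₁ w₂ w₃} →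
       unary {Γ} {Θ} d w₁ (top a w₂) ⇝ top a w₃
  ⊗⊤ₗ : ∀ {Γ X Y} A B b a {w₁ w₂ w₃} {ρ : Proof Y} →
       tensor {Γ} {X} A B b w₁ (top a w₂) ρ ⇝ top a w₃
  ⊗⊤ᵣ : ∀ {Γ X Y} A B b a {w₁ w₂ w₃} {ρ : Proof X} →
       tensor {Γ} {X} {Y} A B b w₁ ρ (top a w₂) ⇝ top a w₃
  &⊤ : ∀ {Γ X Y} A B b a {w₁ w₂ w₃ w₄} →
       amp {Γ} {X} {Y} A B b w₁ (top a w₂) (top a w₃) ⇝ top a w₄
  ⊤⊤ : ∀ {Γ} a b {w₁ w₂} → top {Γ} a w₁ ⇝ top b w₂
  in-u  : ∀ {Γ Θ} d {w} {π π' : Proof Θ} → π ⇝ π' →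
          unary {Γ} d w π ⇝ unary d w π'
  in-⊗ₗ : ∀ {Γ Θ₁ Θ₂} A B a {w} {π π' : Proof Θ₁} {ρ : Proof Θ₂} → π ⇝ π' →
          tensor {Γ} A B a w π ρ ⇝ tensor A B a w π' ρ
  in-⊗ᵣ : ∀ {Γ Θ₁ Θ₂} A B a {w} {ρ : Proof Θ₁} {π π' : Proof Θ₂} → π ⇝ π' →
          tensor {Γ} A B a w ρ π ⇝ tensor A B a w ρ π'
  in-&ₗ : ∀ {Γ Θ₁ Θ₂} A B a {w} {π π' : Proof Θ₁} {ρ : Proof Θ₂} → π ⇝ π' →
          amp {Γ} A B a w π ρ ⇝ amp A B a w π' ρ
  in-&ᵣ : ∀ {Γ Θ₁ Θ₂} A B a {w} {ρ : Proof Θ₁} {π π' : Proof Θ₂} → π ⇝ π' →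
          amp {Γ} A B a w ρ π ⇝ amp A B a w ρ π'

-- Identity of proofs up to exchange: same rules on the same occurrences,
-- sequents only reordered (exchange witnesses ignored).
infix 4 _≅_
data _≅_ : ∀ {Γ Δ} → Proof Γ → Proof Δ → Set where
  ax     : ∀ {Γ Δ} A a b {w w'} → ax {Γ} A a b w ≅ ax {Δ} A a b w'
  one    : ∀ {Γ Δ} a {w w'} → one {Γ} a w ≅ one {Δ} a w'
  top    : ∀ {Γ Δ} a {w w'} → Γ ↭ Δ → top {Γ} a w ≅ top {Δ} a w'
  unary  : ∀ {Γ Δ Θ Θ'} d {w w'} {π : Proof Θ} {π' : Proof Θ'} → π ≅ π' →
           unary {Γ} d w π ≅ unary {Δ} d w' π'
  tensor : ∀ {Γ Δ Θ₁ Θ₂ Θ₁' Θ₂'} A B a {w w'}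
             {π₁ : Proof Θ₁} {π₂ : Proof Θ₂} {π₁' : Proof Θ₁'} {π₂' : Proof Θ₂'} →
           π₁ ≅ π₁' → π₂ ≅ π₂' →
           tensor {Γ} A B a w π₁ π₂ ≅ tensor {Δ} A B a w' π₁' π₂'
  amp    : ∀ {Γ Δ Θ₁ Θ₂ Θ₁' Θ₂'} A B a {w w'}
             {π₁ : Proof Θ₁} {π₂ : Proof Θ₂} {π₁' : Proof Θ₁'} {π₂' : Proof Θ₂'} →
           π₁ ≅ π₁' → π₂ ≅ π₂' →
           amp {Γ} A B a w π₁ π₂ ≅ amp {Δ} A B a w' π₁' π₂'

PProof : Set
PProof = Σ Seq Proof

data CommStep : PProof → PProof → Set where
  fwd  : ∀ {Γ} {π π' : Proof Γ} → π ⇝ π' → CommStep (Γ , π) (Γ , π')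
  bwd  : ∀ {Γ} {π π' : Proof Γ} → π' ⇝ π → CommStep (Γ , π) (Γ , π')
  exch : ∀ {Γ Δ} {π : Proof Γ} {π' : Proof Δ} → π ≅ π' → CommStep (Γ , π) (Δ , π')

infix 4 _≡ᶜ_
_≡ᶜ_ : PProof → PProof → Set
_≡ᶜ_ = Star CommStep

infix 4 _≼_
data _≼_ : Formula → Formula → Set where
  here : ∀ {A} → A ≼ A
  ⊗ₗ : ∀ {S A B} → S ≼ A → S ≼ A ⊗ B
  ⊗ᵣ : ∀ {S A B} → S ≼ B → S ≼ A ⊗ B
  ⅋ₗ : ∀ {S A B} → S ≼ A → S ≼ A ⅋ B
  ⅋ᵣ : ∀ {S A B} → S ≼ B → S ≼ A ⅋ B
  ⊕ₗ : ∀ {S A B} → S ≼ A → S ≼ A ⊕ B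
  ⊕ᵣ : ∀ {S A B} → S ≼ B → S ≼ A ⊕ B
  &ₗ : ∀ {S A B} → S ≼ A → S ≼ A & B
  &ᵣ : ∀ {S A B} → S ≼ B → S ≼ A & B

data Undistributed : Formula → Set where
  b1  : ∀ A B C → Undistributed (A ⊗ (B ⊕ C))
  b2  : ∀ A B C → Undistributed ((A ⊕ B) ⊗ C)
  b3  : ∀ A → Undistributed (A ⊗ 𝟙)
  b4  : ∀ A → Undistributed (𝟙 ⊗ A)
  b5  : ∀ A → Undistributed (A ⊕ 𝟘)
  b6  : ∀ A → Undistributed (𝟘 ⊕ A)
  b7  : ∀ A → Undistributed (A ⊗ 𝟘)
  b8  : ∀ A → Undistributed (𝟘 ⊗ A)
  b9  : ∀ A B C → Undistributed ((C & B) ⅋ A)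
  b10 : ∀ A B C → Undistributed (C ⅋ (B & A))
  b11 : ∀ A → Undistributed (⊥ₗ ⅋ A)
  b12 : ∀ A → Undistributed (A ⅋ ⊥ₗ)
  b13 : ∀ A → Undistributed (⊤ₗ & A)
  b14 : ∀ A → Undistributed (A & ⊤ₗ)
  b15 : ∀ A → Undistributed (⊤ₗ ⅋ A)
  b16 : ∀ A → Undistributed (A ⅋ ⊤ₗ)

Distributed : Formula → Set
Distributed A = ∀ {S} → S ≼ A → ¬ Undistributed S

infix 4 _⊑_
data _⊑_ {Δ} (ρ : Proof Δ) : ∀ {Γ} → Proof Γ → Set where
  here  : ρ ⊑ ρ
  in-u  : ∀ {Γ Θ} d {w} {π : Proof Θ} → ρ ⊑ π → ρ ⊑ unary {Γ} d w π
  in-⊗ₗ : ∀ {Γ Θ₁ Θ₂} A B a {w} {π₁ : Proof Θ₁} {π₂ : Proof Θ₂} →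
          ρ ⊑ π₁ → ρ ⊑ tensor {Γ} A B a w π₁ π₂
  in-⊗ᵣ : ∀ {Γ Θ₁ Θ₂} A B a {w} {π₁ : Proof Θ₁} {π₂ : Proof Θ₂} →
          ρ ⊑ π₂ → ρ ⊑ tensor {Γ} A B a w π₁ π₂
  in-&ₗ : ∀ {Γ Θ₁ Θ₂} A B a {w} {π₁ : Proof Θ₁} {π₂ : Proof Θ₂} →
          ρ ⊑ π₁ → ρ ⊑ amp {Γ} A B a w π₁ π₂
  in-&ᵣ : ∀ {Γ Θ₁ Θ₂} A B a {w} {π₁ : Proof Θ₁} {π₂ : Proof Θ₂} →
          ρ ⊑ π₂ → ρ ⊑ amp {Γ} A B a w π₁ π₂

⊑-trans : ∀ {Δ Σ' Γ} {ρ : Proof Δ} {σ : Proof Σ'} {π : Proof Γ} →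
          ρ ⊑ σ → σ ⊑ π → ρ ⊑ π
⊑-trans s here = s
⊑-trans s (in-u d t) = in-u d (⊑-trans s t)
⊑-trans s (in-⊗ₗ A B a t) = in-⊗ₗ A B a (⊑-trans s t)
⊑-trans s (in-⊗ᵣ A B a t) = in-⊗ᵣ A B a (⊑-trans s t)
⊑-trans s (in-&ₗ A B a t) = in-&ₗ A B a (⊑-trans s t)
⊑-trans s (in-&ᵣ A B a t) = in-&ᵣ A B a (⊑-trans s t)

-- (i) every ⊤-rule has conclusion exactly ⊢ ⊤ , 0 with 0 the dual
--     occurrence of the ⊤ (dualᵃ flips sides, so "or vice versa" is built in)
TopRulesOK : ∀ {Γ} → Proof Γ → Set
TopRulesOK π = ∀ {Δ} (a : Addr) (w : TopW Δ a) → top a w ⊑ π →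
  Δ ↭ (⊤ₗ , a) ∷ (𝟘 , dualᵃ a) ∷ []

data OneChain (c : Addr) : ∀ {Θ} → Proof Θ → Set where
  chain-1  : ∀ {Θ} (w : Θ ↭ (𝟙 , c) ∷ []) → OneChain c (one c w)
  chain-⊕₁ : ∀ {Γ Θ} A B a {w} {σ : Proof Θ} → OneChain c σ →
             OneChain c (unary {Γ} (plus1 A B a) w σ)
  chain-⊕₂ : ∀ {Γ Θ} A B a {w} {σ : Proof Θ} → OneChain c σ →
             OneChain c (unary {Γ} (plus2 A B a) w σ)

OneSumBotPattern : ∀ {Θ} (Δ : Seq) (a : Addr) → Proof Θ → Set
OneSumBotPattern {Θ} Δ a σ = Σ LF λ F →
  (Δ ↭ (⊥ₗ , a) ∷ F ∷ []) × (Θ ↭ F ∷ []) × OneChain (dualᵃ a) σ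

-- (ii) ⊥-rules and 1-rules come in pairs forming 1/⊕/⊥-patterns:
--  every ⊥-rule ends such a pattern, and
BotRulesOK : ∀ {Γ} → Proof Γ → Set
BotRulesOK π = ∀ {Δ Θ} (a : Addr) (w : Unary Δ (⊥ₗ , a) [] Θ) (σ : Proof Θ) →
  unary (bot a) w σ ⊑ π → OneSumBotPattern Δ a σ

--  every 1-rule (at its position s) lies strictly above some ⊥-rule
--  (at position t) inside that ⊥-rule's pattern.
OneRulesOK : ∀ {Γ} → Proof Γ → Set
OneRulesOK π = ∀ {Δ} (c : Addr) (w : Δ ↭ (𝟙 , c) ∷ []) (s : one c w ⊑ π) →
  Σ Addr λ a → Σ Seq λ Δ' → Σ Seq λ Θ → Σ (Unary Δ' (⊥ₗ , a) [] Θ) λ w' →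
  Σ (Proof Θ) λ σ → Σ (unary (bot a) w' σ ⊑ π) λ t → Σ (one c w ⊑ σ) λ u →
  s ≡ ⊑-trans (in-u (bot a) u) t

NoWithSequent : ∀ {Γ} → Proof Γ → Set
NoWithSequent π = ∀ {Δ} (ρ : Proof Δ) → ρ ⊑ π →
  ∀ (B C : Formula) (a : Addr) → ¬ (Δ ↭ (B & C , a) ∷ [])

{-# OPTIONS --safe #-}
-- The invariant is IdLike: every ⊤-rule concludes ⊢ ⊤ , 0 on dual occurrences,
-- every ⊥-rule ends a 1/⊕/⊥-pattern (1-rules occur nowhere else), and no &-rule
-- concludes a one-formula sequent.  id_A is IdLike, and each commutation step
-- preserves and reflects IdLike as long as its conclusion is admissible: its
-- occurrences are pairwise independent and their formulas distributed, which
-- holds for ⊢ A^⊥ , A (distributedness is self-dual) and passes to premises.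
-- The steps that could break the invariant are excluded by exactly the
-- forbidden shapes: a ⊥ pushed into a ⊗-premise ⊢ 1 or ⊢ B ⊕ C, or a ⊤-rule
-- absorbing a ⊕ or ⊗ whose active formula is the 0 dual to the ⊤; independence
-- rules out the remaining ones.  The four properties are read off IdLike.

module Submission where

open import Defs
open import Data.List using (List; []; _∷_)
open import Data.Product using (_×_; _,_)

open import Data.Empty using (⊥; ⊥-elim)
open import Data.Unit using (⊤; tt)
open import Data.List using ([_]; _++_; _∷ʳ_)
open import Data.List.Properties
  using (++-assoc; ++-cancelʳ; ∷ʳ-injectiveʳ; ++-identityˡ-unique; ++-conicalʳ; ∷-injectiveʳ)
open import Data.List.Properties using (map-∘; map-cong; map-id)
open import Data.List.Membership.Propositional using (_∈_)
open import Data.List.Relation.Unary.Any using (here; there)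
open import Data.List.Relation.Unary.All using (All; []; _∷_)
import Data.List.Relation.Unary.All as All
import Data.List.Relation.Unary.All.Properties as All
open import Data.List.Relation.Unary.AllPairs using (AllPairs; []; _∷_)
import Data.List.Relation.Unary.AllPairs.Properties as AllPairs
open import Data.List.Relation.Binary.Permutation.Propositional
  using (_↭_; ↭-refl; ↭-sym; ↭-trans; ↭-prep; ↭-swap; ↭⇒↭ₛ)
open import Data.List.Relation.Binary.Permutation.Propositional.Properties
  using (↭-singleton-inv; ↭-length; ∈-resp-↭; All-resp-↭; drop-∷; ++⁺; ++-comm)
import Data.List.Relation.Binary.Permutation.Setoid.Properties as Permutationₛ
open import Data.Product using (Σ; ∃; proj₁; proj₂)
import Data.Product as Product
open import Data.Product.Function.NonDependent.Propositional using (_×-⇔_)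
open import Data.Sum using (_⊎_; inj₁; inj₂)
open import Function using (_∘_; flip; case_of_; _⇔_; mk⇔; Equivalence)
open import Function.Construct.Identity using (⇔-id)
open import Relation.Nullary using (¬_; contradiction)
open import Relation.Binary.PropositionalEquality
  using (_≡_; _≢_; refl; sym; trans; cong; subst; resp₂; setoid)
open import Relation.Binary.Construct.Closure.ReflexiveTransitive using (ε; _◅_; fold)

^⊥-involutive : ∀ A → A ^⊥ ^⊥ ≡ A
^⊥-involutive (atom n) = refl
^⊥-involutive (natom n) = refl
^⊥-involutive (A ⊗ B) rewrite ^⊥-involutive A | ^⊥-involutive B = refl
^⊥-involutive (A ⅋ B) rewrite ^⊥-involutive A | ^⊥-involutive B = refl
^⊥-involutive (A ⊕ B) rewrite ^⊥-involutive A | ^⊥-involutive B = refl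
^⊥-involutive (A & B) rewrite ^⊥-involutive A | ^⊥-involutive B = refl
^⊥-involutive 𝟙 = refl
^⊥-involutive ⊥ₗ = refl
^⊥-involutive 𝟘 = refl
^⊥-involutive ⊤ₗ = refl

≼-trans : ∀ {S T U} → S ≼ T → T ≼ U → S ≼ U
≼-trans s here = s
≼-trans s (⊗ₗ t) = ⊗ₗ (≼-trans s t)
≼-trans s (⊗ᵣ t) = ⊗ᵣ (≼-trans s t)
≼-trans s (⅋ₗ t) = ⅋ₗ (≼-trans s t)
≼-trans s (⅋ᵣ t) = ⅋ᵣ (≼-trans s t)
≼-trans s (⊕ₗ t) = ⊕ₗ (≼-trans s t)
≼-trans s (⊕ᵣ t) = ⊕ᵣ (≼-trans s t)
≼-trans s (&ₗ t) = &ₗ (≼-trans s t)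
≼-trans s (&ᵣ t) = &ᵣ (≼-trans s t)

≼-^⊥ : ∀ {S A} → S ≼ A → S ^⊥ ≼ A ^⊥
≼-^⊥ here = here
≼-^⊥ (⊗ₗ s) = ⅋ᵣ (≼-^⊥ s)
≼-^⊥ (⊗ᵣ s) = ⅋ₗ (≼-^⊥ s)
≼-^⊥ (⅋ₗ s) = ⊗ᵣ (≼-^⊥ s)
≼-^⊥ (⅋ᵣ s) = ⊗ₗ (≼-^⊥ s)
≼-^⊥ (⊕ₗ s) = &ᵣ (≼-^⊥ s)
≼-^⊥ (⊕ᵣ s) = &ₗ (≼-^⊥ s)
≼-^⊥ (&ₗ s) = ⊕ᵣ (≼-^⊥ s)
≼-^⊥ (&ᵣ s) = ⊕ₗ (≼-^⊥ s)

Undistributed-^⊥ : ∀ {S} → Undistributed S → Undistributed (S ^⊥)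
Undistributed-^⊥ (b1 A B C) = b9 (A ^⊥) (B ^⊥) (C ^⊥)
Undistributed-^⊥ (b2 A B C) = b10 (A ^⊥) (B ^⊥) (C ^⊥)
Undistributed-^⊥ (b3 A) = b11 (A ^⊥)
Undistributed-^⊥ (b4 A) = b12 (A ^⊥)
Undistributed-^⊥ (b5 A) = b13 (A ^⊥)
Undistributed-^⊥ (b6 A) = b14 (A ^⊥)
Undistributed-^⊥ (b7 A) = b15 (A ^⊥)
Undistributed-^⊥ (b8 A) = b16 (A ^⊥)
Undistributed-^⊥ (b9 A B C) = b1 (A ^⊥) (B ^⊥) (C ^⊥)
Undistributed-^⊥ (b10 A B C) = b2 (A ^⊥) (B ^⊥) (C ^⊥)
Undistributed-^⊥ (b11 A) = b3 (A ^⊥)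
Undistributed-^⊥ (b12 A) = b4 (A ^⊥)
Undistributed-^⊥ (b13 A) = b5 (A ^⊥)
Undistributed-^⊥ (b14 A) = b6 (A ^⊥)
Undistributed-^⊥ (b15 A) = b7 (A ^⊥)
Undistributed-^⊥ (b16 A) = b8 (A ^⊥)

Distributed-≼ : ∀ {S A} → S ≼ A → Distributed A → Distributed S
Distributed-≼ s dist t = dist (≼-trans t s)

Distributed-^⊥ : ∀ {A} → Distributed A → Distributed (A ^⊥)
Distributed-^⊥ {A} dist {S} s u =
  dist (subst (S ^⊥ ≼_) (^⊥-involutive A) (≼-^⊥ s)) (Undistributed-^⊥ u)

data OneOrSum : Formula → Set where
  one : OneOrSum 𝟙
  sum : ∀ A B → OneOrSum (A ⊕ B)

OneOrSum-⊗ˡ-undistributed : ∀ {A} B → OneOrSum A → Undistributed (A ⊗ B)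
OneOrSum-⊗ˡ-undistributed B one = b4 B
OneOrSum-⊗ˡ-undistributed B (sum A₁ A₂) = b2 A₁ A₂ B

OneOrSum-⊗ʳ-undistributed : ∀ A {B} → OneOrSum B → Undistributed (A ⊗ B)
OneOrSum-⊗ʳ-undistributed A one = b3 A
OneOrSum-⊗ʳ-undistributed A (sum B₁ B₂) = b1 A B₁ B₂

flipS-involutive : ∀ s → flipS (flipS s) ≡ s
flipS-involutive inA⊥ = refl
flipS-involutive inA = refl

flipD-involutive : ∀ d → flipD (flipD d) ≡ d
flipD-involutive lft = refl
flipD-involutive rgt = refl

dualᵃ-involutive : ∀ a → dualᵃ (dualᵃ a) ≡ a
dualᵃ-involutive (s , p) rewrite flipS-involutive s
  | sym (map-∘ {g = flipD} {f = flipD} p) | map-cong flipD-involutive p | map-id p = refl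

infix 4 _⊴_ _∥_

-- Paths list the innermost step first, so an ancestor's path is a suffix.
record _⊴_ (a c : Addr) : Set where
  constructor below
  field
    same-side : proj₁ a ≡ proj₁ c
    steps : List Dir
    path : proj₂ c ≡ steps ++ proj₂ a

⊴-refl : ∀ {a} → a ⊴ a
⊴-refl = below refl [] refl

⊴-◂ : ∀ a d → a ⊴ a ◂ d
⊴-◂ a d = below refl [ d ] refl

◂⊴⇒⊴ : ∀ {a d c} → a ◂ d ⊴ c → a ⊴ c
◂⊴⇒⊴ {_ , p} {d} (below s≡t ds q) = below s≡t (ds ∷ʳ d) (trans q (sym (++-assoc ds [ d ] p)))

◂⊴-agree : ∀ {a d e c} → a ◂ d ⊴ c → a ◂ e ⊴ c → d ≡ e
◂⊴-agree {_ , p} {d} {e} (below _ ds₁ q₁) (below _ ds₂ q₂) =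
  ∷ʳ-injectiveʳ ds₁ ds₂ (++-cancelʳ p (ds₁ ∷ʳ d) (ds₂ ∷ʳ e)
    (trans (++-assoc ds₁ [ d ] p) (trans (sym q₁) (trans q₂ (sym (++-assoc ds₂ [ e ] p))))))

⊴-◂⁻ : ∀ {c a d} → c ⊴ a ◂ d → c ≡ a ◂ d ⊎ c ⊴ a
⊴-◂⁻ (below refl [] refl) = inj₁ refl
⊴-◂⁻ (below refl (_ ∷ ds) q) = inj₂ (below refl ds (∷-injectiveʳ q))

◂-irrefl : ∀ {a d} → a ≢ a ◂ d
◂-irrefl {d = d} a≡a◂d = case ++-identityˡ-unique [ d ] (cong proj₂ a≡a◂d) of λ ()

lft≢rgt : lft ≢ rgt
lft≢rgt ()

record _∥_ (x y : LF) : Set where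
  constructor incomparable
  field
    ⋬ : ¬ proj₂ x ⊴ proj₂ y
    ⋭ : ¬ proj₂ y ⊴ proj₂ x

∥-sym : ∀ {x y} → x ∥ y → y ∥ x
∥-sym (incomparable x⋬y y⋬x) = incomparable y⋬x x⋬y

siblings-∥ : ∀ {F G a} → (F , a ◂ lft) ∥ (G , a ◂ rgt)
siblings-∥ = incomparable (λ l⊴r → lft≢rgt (◂⊴-agree l⊴r ⊴-refl))
                          (λ r⊴l → lft≢rgt (◂⊴-agree ⊴-refl r⊴l))

record Child (P c : LF) : Set where
  constructor child
  field
    subformula : proj₁ c ≼ proj₁ P
    dir : Dir
    address : proj₂ c ≡ proj₂ P ◂ dir

∥-child : ∀ {P c x} → P ∥ x → Child P c → c ∥ x
∥-child {P} {c} {x} (incomparable P⋬x x⋬P) (child _ d c≡P◂d) = incomparable c⋬x x⋬c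
  where
  c⋬x : ¬ proj₂ c ⊴ proj₂ x
  c⋬x c⊴x = P⋬x (◂⊴⇒⊴ (subst (_⊴ proj₂ x) c≡P◂d c⊴x))

  x⋬c : ¬ proj₂ x ⊴ proj₂ c
  x⋬c x⊴c with ⊴-◂⁻ (subst (proj₂ x ⊴_) c≡P◂d x⊴c)
  ... | inj₁ x≡P◂d = P⋬x (subst (proj₂ P ⊴_) (sym x≡P◂d) (⊴-◂ (proj₂ P) d))
  ... | inj₂ x⊴P = x⋬P x⊴P

NotSingleton : Seq → Set
NotSingleton Γ = ∀ x → ¬ (Γ ↭ [ x ])

∷↭[-]-inv : ∀ {x y : LF} {D} → x ∷ D ↭ [ y ] → x ≡ y × D ≡ []
∷↭[-]-inv p with ↭-singleton-inv p
... | refl = refl , refl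

↭-singleton-head-inv : ∀ {Γ : Seq} {x y D} → Γ ↭ x ∷ D → Γ ↭ [ y ] → x ≡ y × D ≡ []
↭-singleton-head-inv p q = ∷↭[-]-inv (↭-trans (↭-sym p) q)

¬∷∷↭[-] : ∀ {x y z : LF} {D} → ¬ (x ∷ y ∷ D ↭ [ z ])
¬∷∷↭[-] p with ↭-length p
... | ()

head-∈ : ∀ {Γ : Seq} {x D} → Γ ↭ x ∷ D → x ∈ Γ
head-∈ p = ∈-resp-↭ (↭-sym p) (here refl)

∈-pair⁻ : ∀ {x a b : LF} → x ∈ a ∷ b ∷ [] → x ≡ a ⊎ x ≡ b
∈-pair⁻ (here x≡a) = inj₁ x≡a
∈-pair⁻ (there (here x≡b)) = inj₂ x≡b

∷↭pair-inv : ∀ {x a b : LF} {D} → x ∷ D ↭ a ∷ b ∷ [] →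
             (x ≡ a × D ↭ [ b ]) ⊎ (x ≡ b × D ↭ [ a ])
∷↭pair-inv {a = a} {b = b} p with ∈-pair⁻ (∈-resp-↭ p (here refl))
... | inj₁ refl = inj₁ (refl , drop-∷ p)
... | inj₂ refl = inj₂ (refl , drop-∷ (↭-trans p (↭-swap a b ↭-refl)))

∷∷↭pair-inv : ∀ {x y a b : LF} D → x ∷ y ∷ D ↭ a ∷ b ∷ [] → D ≡ []
∷∷↭pair-inv [] _ = refl
∷∷↭pair-inv (_ ∷ _) p with ↭-length p
... | ()

↭-cancelˡ : ∀ (xs : Seq) {ys zs} → xs ++ ys ↭ xs ++ zs → ys ↭ zs
↭-cancelˡ [] p = p
↭-cancelˡ (_ ∷ xs) p = ↭-cancelˡ xs (drop-∷ p)

NotSingleton-heads : ∀ {Γ : Seq} {x y D E} → Γ ↭ x ∷ D → Γ ↭ y ∷ E → x ≢ y → NotSingleton Γ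
NotSingleton-heads p q x≢y _ r =
  x≢y (trans (proj₁ (↭-singleton-head-inv p r)) (sym (proj₁ (↭-singleton-head-inv q r))))

NotSingleton-premise : ∀ {Γ Θ : Seq} {P x D} xs → Γ ↭ P ∷ D → Θ ↭ x ∷ xs ++ D →
                       NotSingleton Γ → NotSingleton Θ
NotSingleton-premise {D = D} xs p q ns z r
  with refl ← ++-conicalʳ xs D (proj₂ (↭-singleton-head-inv q r)) = ns _ p

record Admissible (Γ : Seq) : Set where
  constructor admissible
  field
    distributed : All (Distributed ∘ proj₁) Γ
    independent : AllPairs _∥_ Γ

open Admissible

Admissible-resp-↭ : ∀ {Γ Δ} → Γ ↭ Δ → Admissible Γ → Admissible Δ
Admissible-resp-↭ p (admissible ds is) =
  admissible (All-resp-↭ p ds)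
             (Permutationₛ.AllPairs-resp-↭ (setoid LF) ∥-sym (resp₂ _∥_) (↭⇒↭ₛ p) is)

Admissible-++⁻ˡ : ∀ xs {ys} → Admissible (xs ++ ys) → Admissible xs
Admissible-++⁻ˡ xs (admissible ds is) = admissible (All.++⁻ˡ xs ds) (prefix xs is)
  where
  prefix : ∀ xs {ys} → AllPairs _∥_ (xs ++ ys) → AllPairs _∥_ xs
  prefix [] _ = []
  prefix (_ ∷ xs) (x∥ ∷ is) = All.++⁻ˡ xs x∥ ∷ prefix xs is

Admissible-distributed : ∀ {Γ F a D} → Admissible Γ → Γ ↭ (F , a) ∷ D → Distributed F
Admissible-distributed adm p = All.lookup (distributed adm) (head-∈ p)

Admissible-head-∥ : ∀ {Γ P D x} → Admissible Γ → Γ ↭ P ∷ D → x ∈ D → P ∥ x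
Admissible-head-∥ adm p x∈D with independent (Admissible-resp-↭ p adm)
... | P∥D ∷ _ = All.lookup P∥D x∈D

Admissible-¬parent-child : ∀ {Γ F G a d D} → Admissible Γ → Γ ↭ (F , a) ∷ D → ¬ (G , a ◂ d) ∈ Γ
Admissible-¬parent-child adm p c∈Γ with ∈-resp-↭ p c∈Γ
... | here c≡P = ◂-irrefl (sym (cong proj₂ c≡P))
... | there c∈D = _∥_.⋬ (Admissible-head-∥ adm p c∈D) (⊴-◂ _ _)

Admissible-premise-NotSingleton : ∀ {Γ Θ F G a d y D D′ D″} → Admissible Γ → Γ ↭ (F , a) ∷ D →
  Θ ↭ (G , a ◂ d) ∷ D′ → Θ ↭ y ∷ D″ → y ∈ Γ → NotSingleton Θ
Admissible-premise-NotSingleton adm p q r y∈Γ z s =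
  Admissible-¬parent-child adm p
    (subst (_∈ _) (trans (proj₁ (↭-singleton-head-inv r s)) (sym (proj₁ (↭-singleton-head-inv q s)))) y∈Γ)

Admissible-children : ∀ {P D As} → Admissible (P ∷ D) → All (Child P) As → AllPairs _∥_ As →
                      Admissible (As ++ D)
Admissible-children (admissible (dP ∷ dD) (P∥D ∷ iD)) cs iAs =
  admissible (All.++⁺ (All.map (λ c {_} → Distributed-≼ (Child.subformula c) dP) cs) dD)
             (AllPairs.++⁺ iAs iD (All.map (λ c → All.map (λ P∥x → ∥-child P∥x c) P∥D) cs))

Admissible-child : ∀ {P c D} → Admissible (P ∷ D) → Child P c → Admissible (c ∷ D)
Admissible-child adm c = Admissible-children adm (c ∷ []) ([] ∷ [])

actives-children : ∀ d → All (Child (principal d)) (actives d) × AllPairs _∥_ (actives d)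
actives-children (bot _) = [] , []
actives-children (par _ _ _) =
  (child (⅋ₗ here) lft refl ∷ child (⅋ᵣ here) rgt refl ∷ []) , (siblings-∥ ∷ []) ∷ [] ∷ []
actives-children (plus1 _ _ _) = (child (⊕ₗ here) lft refl ∷ []) , [] ∷ []
actives-children (plus2 _ _ _) = (child (⊕ᵣ here) rgt refl ∷ []) , [] ∷ []

Admissible-unary : ∀ {Γ Θ} d → Admissible Γ → Unary Γ (principal d) (actives d) Θ → Admissible Θ
Admissible-unary d adm (_ , p , q) =
  Admissible-resp-↭ (↭-sym q)
    (Product.uncurry (Admissible-children (Admissible-resp-↭ p adm)) (actives-children d))

Admissible-tensor : ∀ {Γ Θ₁ Θ₂ A B a} → Admissible Γ →
  Split Γ (A ⊗ B , a) (A , a ◂ lft) Θ₁ (B , a ◂ rgt) Θ₂ → Admissible Θ₁ × Admissible Θ₂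
Admissible-tensor adm (Δ₁ , Δ₂ , p , q₁ , q₂) =
  Admissible-resp-↭ (↭-sym q₁)
    (Admissible-child (Admissible-++⁻ˡ (_ ∷ Δ₁) (Admissible-resp-↭ p adm))
                      (child (⊗ₗ here) lft refl)) ,
  Admissible-resp-↭ (↭-sym q₂)
    (Admissible-child (Admissible-++⁻ˡ (_ ∷ Δ₂)
                        (Admissible-resp-↭ (↭-trans p (↭-prep _ (++-comm Δ₁ Δ₂))) adm))
                      (child (⊗ᵣ here) rgt refl))

Admissible-amp : ∀ {Γ Θ₁ Θ₂ A B a} → Admissible Γ →
  Share Γ (A & B , a) (A , a ◂ lft) Θ₁ (B , a ◂ rgt) Θ₂ → Admissible Θ₁ × Admissible Θ₂
Admissible-amp adm (_ , p , q₁ , q₂) =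
  Admissible-resp-↭ (↭-sym q₁) (Admissible-child adm′ (child (&ₗ here) lft refl)) ,
  Admissible-resp-↭ (↭-sym q₂) (Admissible-child adm′ (child (&ᵣ here) rgt refl))
  where adm′ = Admissible-resp-↭ p adm

Admissible-id : ∀ {A} → Distributed A → Admissible ((A ^⊥ , (inA⊥ , [])) ∷ (A , (inA , [])) ∷ [])
Admissible-id dist =
  admissible (Distributed-^⊥ dist ∷ dist ∷ [])
             ((incomparable (λ { (below () _ _) }) (λ { (below () _ _) }) ∷ []) ∷ [] ∷ [])

OneChain-conclusion : ∀ {c Θ x D} {σ : Proof Θ} → OneChain c σ → Θ ↭ x ∷ D →
                      OneOrSum (proj₁ x) × proj₂ x ⊴ c × D ≡ []
OneChain-conclusion (chain-1 w) p with ↭-singleton-head-inv p w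
... | refl , refl = one , ⊴-refl , refl
OneChain-conclusion (chain-⊕₁ A B a {w = _ , p₁ , p₂} ch) p
  with _ , a◂⊴c , refl ← OneChain-conclusion ch p₂
  with refl , refl ← ↭-singleton-head-inv p p₁ = sum A B , ◂⊴⇒⊴ a◂⊴c , refl
OneChain-conclusion (chain-⊕₂ A B a {w = _ , p₁ , p₂} ch) p
  with _ , a◂⊴c , refl ← OneChain-conclusion ch p₂
  with refl , refl ← ↭-singleton-head-inv p p₁ = sum A B , ◂⊴⇒⊴ a◂⊴c , refl

OneChain-⊑ : ∀ {c Θ Δ} {σ : Proof Θ} {ρ : Proof Δ} → OneChain c σ → ρ ⊑ σ → OneChain c ρ
OneChain-⊑ ch here = ch
OneChain-⊑ (chain-⊕₁ _ _ _ ch) (in-u _ s) = OneChain-⊑ ch s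
OneChain-⊑ (chain-⊕₂ _ _ _ ch) (in-u _ s) = OneChain-⊑ ch s

OneChain-⇝ : ∀ {c Γ} {π π′ : Proof Γ} → OneChain c π → π ⇝ π′ → OneChain c π′
OneChain-⇝ (chain-⊕₁ A B a (chain-⊕₁ A′ B′ a′ ch)) (uu _ _) = chain-⊕₁ A′ B′ a′ (chain-⊕₁ A B a ch)
OneChain-⇝ (chain-⊕₁ A B a (chain-⊕₂ A′ B′ a′ ch)) (uu _ _) = chain-⊕₂ A′ B′ a′ (chain-⊕₁ A B a ch)
OneChain-⇝ (chain-⊕₂ A B a (chain-⊕₁ A′ B′ a′ ch)) (uu _ _) = chain-⊕₁ A′ B′ a′ (chain-⊕₂ A B a ch)
OneChain-⇝ (chain-⊕₂ A B a (chain-⊕₂ A′ B′ a′ ch)) (uu _ _) = chain-⊕₂ A′ B′ a′ (chain-⊕₂ A B a ch)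
OneChain-⇝ (chain-⊕₁ A B a ch) (in-u _ st) = chain-⊕₁ A B a (OneChain-⇝ ch st)
OneChain-⇝ (chain-⊕₂ A B a ch) (in-u _ st) = chain-⊕₂ A B a (OneChain-⇝ ch st)

OneChain-⇜ : ∀ {c Γ} {π π′ : Proof Γ} → OneChain c π′ → π ⇝ π′ → OneChain c π
OneChain-⇜ (chain-⊕₁ A B a (chain-⊕₁ A′ B′ a′ ch)) (uu _ _) = chain-⊕₁ A′ B′ a′ (chain-⊕₁ A B a ch)
OneChain-⇜ (chain-⊕₁ A B a (chain-⊕₂ A′ B′ a′ ch)) (uu _ _) = chain-⊕₂ A′ B′ a′ (chain-⊕₁ A B a ch)
OneChain-⇜ (chain-⊕₂ A B a (chain-⊕₁ A′ B′ a′ ch)) (uu _ _) = chain-⊕₁ A′ B′ a′ (chain-⊕₂ A B a ch)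
OneChain-⇜ (chain-⊕₂ A B a (chain-⊕₂ A′ B′ a′ ch)) (uu _ _) = chain-⊕₂ A′ B′ a′ (chain-⊕₂ A B a ch)
OneChain-⇜ (chain-⊕₁ A B a ch) (in-u _ st) = chain-⊕₁ A B a (OneChain-⇜ ch st)
OneChain-⇜ (chain-⊕₂ A B a ch) (in-u _ st) = chain-⊕₂ A B a (OneChain-⇜ ch st)

TopPair : Seq → Addr → Set
TopPair Γ a = Γ ↭ (⊤ₗ , a) ∷ (𝟘 , dualᵃ a) ∷ []

IdLike : ∀ {Γ} → Proof Γ → Set
IdLike (ax _ _ _ _) = ⊤
IdLike (one _ _) = ⊥
IdLike (top {Γ} a _) = TopPair Γ a
IdLike (unary {Γ} (bot a) _ σ) = OneSumBotPattern Γ a σ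
IdLike (unary (par _ _ _) _ σ) = IdLike σ
IdLike (unary (plus1 _ _ _) _ σ) = IdLike σ
IdLike (unary (plus2 _ _ _) _ σ) = IdLike σ
IdLike (tensor _ _ _ _ π₁ π₂) = IdLike π₁ × IdLike π₂
IdLike (amp {Γ} _ _ _ _ π₁ π₂) = IdLike π₁ × IdLike π₂ × NotSingleton Γ

AboveBot : ∀ {Γ Δ} {π : Proof Γ} {ρ : Proof Δ} → ρ ⊑ π → Set
AboveBot {π = π} {ρ} s = Σ Addr λ a → Σ Seq λ Δ′ → Σ Seq λ Θ → Σ (Unary Δ′ (⊥ₗ , a) [] Θ) λ w →
  Σ (Proof Θ) λ σ → Σ (unary (bot a) w σ ⊑ π) λ t → Σ (ρ ⊑ σ) λ u → s ≡ ⊑-trans (in-u (bot a) u) t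

IdLikeAt : ∀ {Γ Δ} {π : Proof Γ} {ρ : Proof Δ} → ρ ⊑ π → Set
IdLikeAt {ρ = ρ} s = IdLike ρ ⊎ (AboveBot s × ∃ λ c → OneChain c ρ)

⊑-trans-assoc : ∀ {Δ Θ Σ′ Γ} {ρ : Proof Δ} {σ : Proof Θ} {τ : Proof Σ′} {π : Proof Γ}
  (r : ρ ⊑ σ) (s : σ ⊑ τ) (t : τ ⊑ π) → ⊑-trans (⊑-trans r s) t ≡ ⊑-trans r (⊑-trans s t)
⊑-trans-assoc r s here = refl
⊑-trans-assoc r s (in-u d t) = cong (in-u d) (⊑-trans-assoc r s t)
⊑-trans-assoc r s (in-⊗ₗ A B a t) = cong (in-⊗ₗ A B a) (⊑-trans-assoc r s t)
⊑-trans-assoc r s (in-⊗ᵣ A B a t) = cong (in-⊗ᵣ A B a) (⊑-trans-assoc r s t)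
⊑-trans-assoc r s (in-&ₗ A B a t) = cong (in-&ₗ A B a) (⊑-trans-assoc r s t)
⊑-trans-assoc r s (in-&ᵣ A B a t) = cong (in-&ᵣ A B a) (⊑-trans-assoc r s t)

IdLikeAt-⊑ : ∀ {Δ Θ Γ} {ρ : Proof Δ} {σ : Proof Θ} {π : Proof Γ} {s : ρ ⊑ σ} →
             IdLikeAt s → (t : σ ⊑ π) → IdLikeAt (⊑-trans s t)
IdLikeAt-⊑ (inj₁ g) t = inj₁ g
IdLikeAt-⊑ (inj₂ ((a , Δ′ , Θ , w , σ , t₀ , u , s≡) , ch)) t =
  inj₂ ((a , Δ′ , Θ , w , σ , ⊑-trans t₀ t , u ,
         trans (cong (λ s′ → ⊑-trans s′ t) s≡) (⊑-trans-assoc (in-u (bot a) u) t₀ t)) , ch)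

IdLike⇒IdLikeAt : ∀ {Γ Δ} {π : Proof Γ} {ρ : Proof Δ} → IdLike π → (s : ρ ⊑ π) → IdLikeAt s
IdLike⇒IdLikeAt g here = inj₁ g
IdLike⇒IdLikeAt (_ , _ , _ , ch) (in-u (bot a) s) =
  inj₂ ((a , _ , _ , _ , _ , here , s , refl) , _ , OneChain-⊑ ch s)
IdLike⇒IdLikeAt g (in-u (par _ _ _) s) = IdLikeAt-⊑ (IdLike⇒IdLikeAt g s) (in-u _ here)
IdLike⇒IdLikeAt g (in-u (plus1 _ _ _) s) = IdLikeAt-⊑ (IdLike⇒IdLikeAt g s) (in-u _ here)
IdLike⇒IdLikeAt g (in-u (plus2 _ _ _) s) = IdLikeAt-⊑ (IdLike⇒IdLikeAt g s) (in-u _ here)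
IdLike⇒IdLikeAt (g , _) (in-⊗ₗ _ _ _ s) = IdLikeAt-⊑ (IdLike⇒IdLikeAt g s) (in-⊗ₗ _ _ _ here)
IdLike⇒IdLikeAt (_ , g) (in-⊗ᵣ _ _ _ s) = IdLikeAt-⊑ (IdLike⇒IdLikeAt g s) (in-⊗ᵣ _ _ _ here)
IdLike⇒IdLikeAt (g , _) (in-&ₗ _ _ _ s) = IdLikeAt-⊑ (IdLike⇒IdLikeAt g s) (in-&ₗ _ _ _ here)
IdLike⇒IdLikeAt (_ , g , _) (in-&ᵣ _ _ _ s) = IdLikeAt-⊑ (IdLike⇒IdLikeAt g s) (in-&ᵣ _ _ _ here)

principal-¬with : ∀ d {B C a} → principal d ≢ (B & C , a)
principal-¬with (bot _) ()
principal-¬with (par _ _ _) ()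
principal-¬with (plus1 _ _ _) ()
principal-¬with (plus2 _ _ _) ()

IdLike-¬with : ∀ {Δ B C a} (ρ : Proof Δ) → IdLike ρ → ¬ (Δ ↭ [ (B & C , a) ])
IdLike-¬with (ax _ _ _ w) _ p = ¬∷∷↭[-] (↭-trans (↭-sym w) p)
IdLike-¬with (top _ (_ , w)) _ p = contradiction (proj₁ (↭-singleton-head-inv w p)) λ ()
IdLike-¬with (unary d (_ , w , _) _) _ p = principal-¬with d (proj₁ (↭-singleton-head-inv w p))
IdLike-¬with (tensor _ _ _ (_ , _ , w , _) _ _) _ p = contradiction (proj₁ (↭-singleton-head-inv w p)) λ ()
IdLike-¬with (amp _ _ _ _ _ _) (_ , _ , ns) p = ns _ p

IdLike⇒TopRulesOK : ∀ {Γ} {π : Proof Γ} → IdLike π → TopRulesOK π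
IdLike⇒TopRulesOK g a w s with IdLike⇒IdLikeAt g s
... | inj₁ g′ = g′
... | inj₂ (_ , _ , ())

IdLike⇒BotRulesOK : ∀ {Γ} {π : Proof Γ} → IdLike π → BotRulesOK π
IdLike⇒BotRulesOK g a w σ s with IdLike⇒IdLikeAt g s
... | inj₁ g′ = g′
... | inj₂ (_ , _ , ())

IdLike⇒OneRulesOK : ∀ {Γ} {π : Proof Γ} → IdLike π → OneRulesOK π
IdLike⇒OneRulesOK g c w s with IdLike⇒IdLikeAt g s
... | inj₂ (above , _) = above

IdLike⇒NoWithSequent : ∀ {Γ} {π : Proof Γ} → IdLike π → NoWithSequent π
IdLike⇒NoWithSequent g ρ s B C a p with IdLike⇒IdLikeAt g s
... | inj₁ g′ = IdLike-¬with ρ g′ p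
... | inj₂ (_ , _ , ch) = case proj₁ (OneChain-conclusion ch p) of λ ()

IdLike-idp : ∀ A a → IdLike (idp A a)
IdLike-idp (atom _) _ = tt
IdLike-idp (natom _) _ = tt
IdLike-idp (A ⊗ B) a = IdLike-idp A (a ◂ lft) , IdLike-idp B (a ◂ rgt)
IdLike-idp (A ⅋ B) a = IdLike-idp B (a ◂ rgt) , IdLike-idp A (a ◂ lft)
IdLike-idp (A ⊕ B) a = IdLike-idp B (a ◂ rgt) , IdLike-idp A (a ◂ lft) , λ _ → ¬∷∷↭[-]
IdLike-idp (A & B) a = IdLike-idp A (a ◂ lft) , IdLike-idp B (a ◂ rgt) , λ _ → ¬∷∷↭[-]
IdLike-idp 𝟙 a =
  _ , ↭-refl , ↭-refl ,
  subst (λ c → OneChain c (one a ↭-refl)) (sym (dualᵃ-involutive a)) (chain-1 ↭-refl)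
IdLike-idp ⊥ₗ _ = _ , ↭-swap _ _ ↭-refl , ↭-refl , chain-1 ↭-refl
IdLike-idp 𝟘 a =
  subst (λ b → (⊤ₗ , dualᵃ a) ∷ (𝟘 , a) ∷ [] ↭ (⊤ₗ , dualᵃ a) ∷ (𝟘 , b) ∷ [])
        (sym (dualᵃ-involutive a)) ↭-refl
IdLike-idp ⊤ₗ _ = ↭-swap _ _ ↭-refl

≅⇒↭ : ∀ {Γ Δ} {π : Proof Γ} {π′ : Proof Δ} → π ≅ π′ → Γ ↭ Δ
≅⇒↭ (ax _ _ _ {w} {w′}) = ↭-trans w (↭-sym w′)
≅⇒↭ (one _ {w} {w′}) = ↭-trans w (↭-sym w′)
≅⇒↭ (top _ Γ↭Δ) = Γ↭Δ
≅⇒↭ (unary d {_ , p , q} {_ , p′ , q′} i) =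
  ↭-trans p (↭-trans (↭-prep _ (↭-cancelˡ (actives d) (↭-trans (↭-sym q) (↭-trans (≅⇒↭ i) q′))))
                     (↭-sym p′))
≅⇒↭ (tensor _ _ _ {_ , _ , p , q₁ , q₂} {_ , _ , p′ , q₁′ , q₂′} i j) =
  ↭-trans p (↭-trans (↭-prep _ (++⁺ (drop-∷ (↭-trans (↭-sym q₁) (↭-trans (≅⇒↭ i) q₁′)))
                                    (drop-∷ (↭-trans (↭-sym q₂) (↭-trans (≅⇒↭ j) q₂′)))))
                     (↭-sym p′))
≅⇒↭ (amp _ _ _ {_ , p , q₁ , _} {_ , p′ , q₁′ , _} i j) =
  ↭-trans p (↭-trans (↭-prep _ (drop-∷ (↭-trans (↭-sym q₁) (↭-trans (≅⇒↭ i) q₁′)))) (↭-sym p′))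

≅-sym : ∀ {Γ Δ} {π : Proof Γ} {π′ : Proof Δ} → π ≅ π′ → π′ ≅ π
≅-sym (ax A a b) = ax A a b
≅-sym (one a) = one a
≅-sym (top a Γ↭Δ) = top a (↭-sym Γ↭Δ)
≅-sym (unary d i) = unary d (≅-sym i)
≅-sym (tensor A B a i j) = tensor A B a (≅-sym i) (≅-sym j)
≅-sym (amp A B a i j) = amp A B a (≅-sym i) (≅-sym j)

OneChain-≅ : ∀ {c Γ Δ} {π : Proof Γ} {π′ : Proof Δ} → OneChain c π → π ≅ π′ → OneChain c π′
OneChain-≅ (chain-1 _) (one _ {w' = w′}) = chain-1 w′
OneChain-≅ (chain-⊕₁ A B a ch) (unary _ i) = chain-⊕₁ A B a (OneChain-≅ ch i)
OneChain-≅ (chain-⊕₂ A B a ch) (unary _ i) = chain-⊕₂ A B a (OneChain-≅ ch i)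

IdLike-≅ : ∀ {Γ Δ} {π : Proof Γ} {π′ : Proof Δ} → π ≅ π′ → IdLike π → IdLike π′
IdLike-≅ (ax _ _ _) _ = tt
IdLike-≅ (top _ Γ↭Δ) g = ↭-trans (↭-sym Γ↭Δ) g
IdLike-≅ i@(unary (bot _) j) (F , p , q , ch) =
  F , ↭-trans (↭-sym (≅⇒↭ i)) p , ↭-trans (↭-sym (≅⇒↭ j)) q , OneChain-≅ ch j
IdLike-≅ (unary (par _ _ _) i) g = IdLike-≅ i g
IdLike-≅ (unary (plus1 _ _ _) i) g = IdLike-≅ i g
IdLike-≅ (unary (plus2 _ _ _) i) g = IdLike-≅ i g
IdLike-≅ (tensor _ _ _ i j) (g₁ , g₂) = IdLike-≅ i g₁ , IdLike-≅ j g₂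
IdLike-≅ k@(amp _ _ _ i j) (g₁ , g₂ , ns) =
  IdLike-≅ i g₁ , IdLike-≅ j g₂ , λ z p → ns z (↭-trans (≅⇒↭ k) p)

absurd⇔ : ∀ {P Q : Set} → ¬ P → ¬ Q → P ⇔ Q
absurd⇔ ¬p ¬q = mk⇔ (⊥-elim ∘ ¬p) (⊥-elim ∘ ¬q)

IsTopOrZero : Formula → Set
IsTopOrZero ⊤ₗ = ⊤
IsTopOrZero 𝟘 = ⊤
IsTopOrZero _ = ⊥

TopW-∈ : ∀ {Γ a} → TopW Γ a → (⊤ₗ , a) ∈ Γ
TopW-∈ (_ , p) = head-∈ p

TopPair-head : ∀ {Γ a F b D} → TopPair Γ a → Γ ↭ (F , b) ∷ D → IsTopOrZero F
TopPair-head g p with ∈-pair⁻ (∈-resp-↭ g (head-∈ p))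
... | inj₁ refl = tt
... | inj₂ refl = tt

TopPair-move : ∀ {Γ a b} → TopPair Γ a → TopW Γ b → TopPair Γ b
TopPair-move g w with ∈-pair⁻ (∈-resp-↭ g (TopW-∈ w))
... | inj₁ refl = g

TopPair-child : ∀ {Γ Δ F C a b d D} → Admissible Γ → Γ ↭ (F , b) ∷ D → (⊤ₗ , a) ∈ Γ →
                TopPair ((C , b ◂ d) ∷ Δ) a → (C , b ◂ d) ≡ (𝟘 , dualᵃ a)
TopPair-child adm p ⊤∈Γ g with ∷↭pair-inv g
... | inj₁ (refl , _) = ⊥-elim (Admissible-¬parent-child adm p ⊤∈Γ)
... | inj₂ (c≡𝟘 , _) = c≡𝟘

¬TopPair-⅋-premise : ∀ {Γ Θ A B a c} → Admissible Γ → TopW Γ a →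
  Unary Γ (A ⅋ B , c) ((A , c ◂ lft) ∷ (B , c ◂ rgt) ∷ []) Θ → ¬ TopPair Θ a
¬TopPair-⅋-premise adm w (D , p , q) g with ∈-resp-↭ p (TopW-∈ w)
... | there ⊤∈D with refl ← ∷∷↭pair-inv D (↭-trans (↭-sym q) g) = case ⊤∈D of λ ()

¬TopPair-⊕₁-premise : ∀ {Γ Θ A B a c} → Admissible Γ → TopW Γ a →
  Unary Γ (A ⊕ B , c) [ (A , c ◂ lft) ] Θ → ¬ TopPair Θ a
¬TopPair-⊕₁-premise {B = B} adm w (_ , p , q) g
  with refl ← cong proj₁ (TopPair-child adm p (TopW-∈ w) (↭-trans (↭-sym q) g)) =
  Admissible-distributed adm p here (b6 B)

¬TopPair-⊕₂-premise : ∀ {Γ Θ A B a c} → Admissible Γ → TopW Γ a →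
  Unary Γ (A ⊕ B , c) [ (B , c ◂ rgt) ] Θ → ¬ TopPair Θ a
¬TopPair-⊕₂-premise {A = A} adm w (_ , p , q) g
  with refl ← cong proj₁ (TopPair-child adm p (TopW-∈ w) (↭-trans (↭-sym q) g)) =
  Admissible-distributed adm p here (b5 A)

¬TopPair-⊗-premiseˡ : ∀ {Γ X Y A B a b} → Admissible Γ → TopW Γ a →
  Split Γ (A ⊗ B , b) (A , b ◂ lft) X (B , b ◂ rgt) Y → ¬ TopPair X a
¬TopPair-⊗-premiseˡ {B = B} adm w (_ , _ , p , q , _) g
  with refl ← cong proj₁ (TopPair-child adm p (TopW-∈ w) (↭-trans (↭-sym q) g)) =
  Admissible-distributed adm p here (b8 B)

¬TopPair-⊗-premiseʳ : ∀ {Γ X Y A B a b} → Admissible Γ → TopW Γ a →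
  Split Γ (A ⊗ B , b) (A , b ◂ lft) X (B , b ◂ rgt) Y → ¬ TopPair Y a
¬TopPair-⊗-premiseʳ {A = A} adm w (_ , _ , p , _ , q) g
  with refl ← cong proj₁ (TopPair-child adm p (TopW-∈ w) (↭-trans (↭-sym q) g)) =
  Admissible-distributed adm p here (b7 A)

¬TopPair-&-premises : ∀ {Γ X Y A B a b} → Admissible Γ → TopW Γ a →
  Share Γ (A & B , b) (A , b ◂ lft) X (B , b ◂ rgt) Y → TopPair X a → ¬ TopPair Y a
¬TopPair-&-premises adm w (_ , p , q₁ , q₂) g₁ g₂ =
  case trans (cong proj₂ (TopPair-child adm p (TopW-∈ w) (↭-trans (↭-sym q₁) g₁)))
             (sym (cong proj₂ (TopPair-child adm p (TopW-∈ w) (↭-trans (↭-sym q₂) g₂)))) of λ ()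

IdLike-u⊤ : ∀ {Γ Θ} d a (w₁ : Unary Γ (principal d) (actives d) Θ) (w₂ : TopW Θ a) (w₃ : TopW Γ a) →
  Admissible Γ → IdLike (unary d w₁ (top a w₂)) ⇔ IdLike (top a w₃)
IdLike-u⊤ (bot _) _ (_ , p , _) _ _ _ =
  absurd⇔ (λ { (_ , _ , _ , ()) }) (flip TopPair-head p)
IdLike-u⊤ (par _ _ _) _ w₁@(_ , p , _) _ w adm =
  absurd⇔ (¬TopPair-⅋-premise adm w w₁) (flip TopPair-head p)
IdLike-u⊤ (plus1 _ _ _) _ w₁@(_ , p , _) _ w adm =
  absurd⇔ (¬TopPair-⊕₁-premise adm w w₁) (flip TopPair-head p)
IdLike-u⊤ (plus2 _ _ _) _ w₁@(_ , p , _) _ w adm =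
  absurd⇔ (¬TopPair-⊕₂-premise adm w w₁) (flip TopPair-head p)

IdLike-uu : ∀ d e {Γ Θ Θ′ Ξ}
  (w₁ : Unary Γ (principal d) (actives d) Θ) (w₂ : Unary Θ (principal e) (actives e) Ξ)
  (w₃ : Unary Γ (principal e) (actives e) Θ′) (w₄ : Unary Θ′ (principal d) (actives d) Ξ)
  (π : Proof Ξ) → IdLike (unary d w₁ (unary e w₂ π)) → IdLike (unary e w₃ (unary d w₄ π))
IdLike-uu (bot _) (bot _) _ _ _ _ _ (_ , _ , _ , ())
IdLike-uu (bot _) (par _ _ _) _ _ _ _ _ (_ , _ , _ , ())
IdLike-uu (bot _) (plus1 _ _ _) _ (_ , p , q) _ (_ , r , s) _ (_ , _ , t , chain-⊕₁ _ _ _ ch)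
  with refl , refl ← ↭-singleton-head-inv p t =
  _ , ↭-trans r (↭-prep _ (↭-trans (↭-sym s) q)) , q , ch
IdLike-uu (bot _) (plus2 _ _ _) _ (_ , p , q) _ (_ , r , s) _ (_ , _ , t , chain-⊕₂ _ _ _ ch)
  with refl , refl ← ↭-singleton-head-inv p t =
  _ , ↭-trans r (↭-prep _ (↭-trans (↭-sym s) q)) , q , ch
IdLike-uu (par _ _ _) (bot _) _ _ _ (_ , _ , s) _ (_ , _ , t , _) =
  ⊥-elim (¬∷∷↭[-] (↭-trans (↭-sym s) t))
IdLike-uu (plus1 A B a) (bot _) _ _ (_ , p , q) (_ , r , s) _ (_ , _ , t , ch)
  with refl , refl ← ↭-singleton-head-inv s t =
  _ , ↭-trans p (↭-prep _ (↭-trans (↭-sym q) r)) , r , chain-⊕₁ A B a ch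
IdLike-uu (plus2 A B a) (bot _) _ _ (_ , p , q) (_ , r , s) _ (_ , _ , t , ch)
  with refl , refl ← ↭-singleton-head-inv s t =
  _ , ↭-trans p (↭-prep _ (↭-trans (↭-sym q) r)) , r , chain-⊕₂ A B a ch
IdLike-uu (par _ _ _) (par _ _ _) _ _ _ _ _ g = g
IdLike-uu (par _ _ _) (plus1 _ _ _) _ _ _ _ _ g = g
IdLike-uu (par _ _ _) (plus2 _ _ _) _ _ _ _ _ g = g
IdLike-uu (plus1 _ _ _) (par _ _ _) _ _ _ _ _ g = g
IdLike-uu (plus1 _ _ _) (plus1 _ _ _) _ _ _ _ _ g = g
IdLike-uu (plus1 _ _ _) (plus2 _ _ _) _ _ _ _ _ g = g
IdLike-uu (plus2 _ _ _) (par _ _ _) _ _ _ _ _ g = g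
IdLike-uu (plus2 _ _ _) (plus1 _ _ _) _ _ _ _ _ g = g
IdLike-uu (plus2 _ _ _) (plus2 _ _ _) _ _ _ _ _ g = g

IdLike-&& : ∀ {Γ X Y Θ₁₁ Θ₁₂ Θ₂₁ Θ₂₂ X′ Y′} A B a C D c
  (w₁ : Share Γ (A & B , a) (A , a ◂ lft) X (B , a ◂ rgt) Y)
  (w₂ : Share X (C & D , c) (C , c ◂ lft) Θ₁₁ (D , c ◂ rgt) Θ₁₂)
  (w₃ : Share Y (C & D , c) (C , c ◂ lft) Θ₂₁ (D , c ◂ rgt) Θ₂₂)
  (w₄ : Share Γ (C & D , c) (C , c ◂ lft) X′ (D , c ◂ rgt) Y′)
  (w₅ : Share X′ (A & B , a) (A , a ◂ lft) Θ₁₁ (B , a ◂ rgt) Θ₂₁)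
  (w₆ : Share Y′ (A & B , a) (A , a ◂ lft) Θ₁₂ (B , a ◂ rgt) Θ₂₂)
  (π₁₁ : Proof Θ₁₁) (π₁₂ : Proof Θ₁₂) (π₂₁ : Proof Θ₂₁) (π₂₂ : Proof Θ₂₂) →
  IdLike (amp A B a w₁ (amp C D c w₂ π₁₁ π₁₂) (amp C D c w₃ π₂₁ π₂₂)) →
  IdLike (amp C D c w₄ (amp A B a w₅ π₁₁ π₂₁) (amp A B a w₆ π₁₂ π₂₂))
IdLike-&& _ _ _ _ _ _ _ _ _ (_ , p , q₁ , q₂) _ _ _ _ _ _ ((g₁₁ , g₁₂ , _) , (g₂₁ , g₂₂ , _) , ns) =
  (g₁₁ , g₂₁ , NotSingleton-premise [] p q₁ ns) , (g₁₂ , g₂₂ , NotSingleton-premise [] p q₂ ns) , ns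

IdLike-u⊗ₗ : ∀ {Γ Θ Θ₁ Θ₂ Θ₁′} d A B a
  (w₁ : Unary Γ (principal d) (actives d) Θ)
  (w₂ : Split Θ (A ⊗ B , a) (A , a ◂ lft) Θ₁ (B , a ◂ rgt) Θ₂)
  (w₃ : Split Γ (A ⊗ B , a) (A , a ◂ lft) Θ₁′ (B , a ◂ rgt) Θ₂)
  (w₄ : Unary Θ₁′ (principal d) (actives d) Θ₁) (π₁ : Proof Θ₁) (π₂ : Proof Θ₂) → Admissible Γ →
  IdLike (unary d w₁ (tensor A B a w₂ π₁ π₂)) ⇔ IdLike (tensor A B a w₃ (unary d w₄ π₁) π₂)
IdLike-u⊗ₗ (bot _) _ B _ _ (_ , _ , _ , q , _) (_ , _ , p , _) _ _ _ adm =
  absurd⇔ (λ { (_ , _ , _ , ()) })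
          (λ ((_ , _ , _ , ch) , _) →
             Admissible-distributed adm p here
               (OneOrSum-⊗ˡ-undistributed B (proj₁ (OneChain-conclusion ch q))))
IdLike-u⊗ₗ (par _ _ _) _ _ _ _ _ _ _ _ _ _ = ⇔-id _
IdLike-u⊗ₗ (plus1 _ _ _) _ _ _ _ _ _ _ _ _ _ = ⇔-id _
IdLike-u⊗ₗ (plus2 _ _ _) _ _ _ _ _ _ _ _ _ _ = ⇔-id _

IdLike-u⊗ᵣ : ∀ {Γ Θ Θ₁ Θ₂ Θ₂′} d A B a
  (w₁ : Unary Γ (principal d) (actives d) Θ)
  (w₂ : Split Θ (A ⊗ B , a) (A , a ◂ lft) Θ₁ (B , a ◂ rgt) Θ₂)
  (w₃ : Split Γ (A ⊗ B , a) (A , a ◂ lft) Θ₁ (B , a ◂ rgt) Θ₂′)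
  (w₄ : Unary Θ₂′ (principal d) (actives d) Θ₂) (π₁ : Proof Θ₁) (π₂ : Proof Θ₂) → Admissible Γ →
  IdLike (unary d w₁ (tensor A B a w₂ π₁ π₂)) ⇔ IdLike (tensor A B a w₃ π₁ (unary d w₄ π₂))
IdLike-u⊗ᵣ (bot _) A _ _ _ (_ , _ , _ , _ , q) (_ , _ , p , _) _ _ _ adm =
  absurd⇔ (λ { (_ , _ , _ , ()) })
          (λ (_ , (_ , _ , _ , ch)) →
             Admissible-distributed adm p here
               (OneOrSum-⊗ʳ-undistributed A (proj₁ (OneChain-conclusion ch q))))
IdLike-u⊗ᵣ (par _ _ _) _ _ _ _ _ _ _ _ _ _ = ⇔-id _
IdLike-u⊗ᵣ (plus1 _ _ _) _ _ _ _ _ _ _ _ _ _ = ⇔-id _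
IdLike-u⊗ᵣ (plus2 _ _ _) _ _ _ _ _ _ _ _ _ _ = ⇔-id _

IdLike-u& : ∀ {Γ Θ Θ₁ Θ₂ Θ₁′ Θ₂′} d A B a
  (w₁ : Unary Γ (principal d) (actives d) Θ)
  (w₂ : Share Θ (A & B , a) (A , a ◂ lft) Θ₁ (B , a ◂ rgt) Θ₂)
  (w₃ : Share Γ (A & B , a) (A , a ◂ lft) Θ₁′ (B , a ◂ rgt) Θ₂′)
  (w₄ : Unary Θ₁′ (principal d) (actives d) Θ₁) (w₅ : Unary Θ₂′ (principal d) (actives d) Θ₂)
  (π₁ : Proof Θ₁) (π₂ : Proof Θ₂) →
  IdLike (unary d w₁ (amp A B a w₂ π₁ π₂)) ⇔ IdLike (amp A B a w₃ (unary d w₄ π₁) (unary d w₅ π₂))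
-- Both copies of the ⊥ pair with the 1 at its dual occurrence, which would have
-- to lie above both children of the &.
IdLike-u& (bot _) _ _ _ _ (_ , _ , q₁ , q₂) _ _ _ _ _ =
  absurd⇔ (λ { (_ , _ , _ , ()) })
          (λ ((_ , _ , _ , ch₁) , (_ , _ , _ , ch₂) , _) →
             let _ , l⊴c , _ = OneChain-conclusion ch₁ q₁
                 _ , r⊴c , _ = OneChain-conclusion ch₂ q₂
             in lft≢rgt (◂⊴-agree l⊴c r⊴c))
IdLike-u& (par _ _ _) _ _ _ (_ , p , q) _ (_ , r , _) _ _ _ _ =
  ⇔-id _ ×-⇔ ⇔-id _ ×-⇔ mk⇔ (λ _ → NotSingleton-heads p r λ ()) (NotSingleton-premise (_ ∷ []) p q)
IdLike-u& (plus1 _ _ _) _ _ _ (_ , p , q) _ (_ , r , _) _ _ _ _ =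
  ⇔-id _ ×-⇔ ⇔-id _ ×-⇔ mk⇔ (λ _ → NotSingleton-heads p r λ ()) (NotSingleton-premise [] p q)
IdLike-u& (plus2 _ _ _) _ _ _ (_ , p , q) _ (_ , r , _) _ _ _ _ =
  ⇔-id _ ×-⇔ ⇔-id _ ×-⇔ mk⇔ (λ _ → NotSingleton-heads p r λ ()) (NotSingleton-premise [] p q)

IdLike-⇝ : ∀ {Γ} {π π′ : Proof Γ} → Admissible Γ → π ⇝ π′ → IdLike π ⇔ IdLike π′
IdLike-⇝ _ (uu d e {w₁} {w₂} {w₃} {w₄} {π}) =
  mk⇔ (IdLike-uu d e w₁ w₂ w₃ w₄ π) (IdLike-uu e d w₃ w₄ w₁ w₂ π)
IdLike-⇝ adm (u⊗ₗ d A B a {w₁} {w₂} {w₃} {w₄} {π₁} {π₂}) = IdLike-u⊗ₗ d A B a w₁ w₂ w₃ w₄ π₁ π₂ adm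
IdLike-⇝ adm (u⊗ᵣ d A B a {w₁} {w₂} {w₃} {w₄} {π₁} {π₂}) = IdLike-u⊗ᵣ d A B a w₁ w₂ w₃ w₄ π₁ π₂ adm
IdLike-⇝ _ (u& d A B a {w₁} {w₂} {w₃} {w₄} {w₅} {π₁} {π₂}) = IdLike-u& d A B a w₁ w₂ w₃ w₄ w₅ π₁ π₂
IdLike-⇝ _ (⊗⊗₁ _ _ _ _ _ _) =
  mk⇔ (λ ((g₁ , g₂) , gρ) → (g₁ , gρ) , g₂) (λ ((g₁ , gρ) , g₂) → (g₁ , g₂) , gρ)
IdLike-⇝ _ (⊗⊗₂ _ _ _ _ _ _) =
  mk⇔ (λ ((g₁ , g₂) , gρ) → g₁ , (g₂ , gρ)) (λ (g₁ , (g₂ , gρ)) → (g₁ , g₂) , gρ)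
IdLike-⇝ _ (⊗⊗₃ _ _ _ _ _ _) =
  mk⇔ (λ (gρ , (g₁ , g₂)) → (gρ , g₁) , g₂) (λ ((gρ , g₁) , g₂) → gρ , (g₁ , g₂))
IdLike-⇝ _ (⊗⊗₄ _ _ _ _ _ _) =
  mk⇔ (λ (gρ , (g₁ , g₂)) → g₁ , (gρ , g₂)) (λ (g₁ , (gρ , g₂)) → gρ , (g₁ , g₂))
IdLike-⇝ adm (⊗&₁ _ _ _ _ _ _ {w₁ = _ , _ , p , q , _} {w₂ = _ , r , _} {w₃ = _ , s , _}) =
  mk⇔ (λ ((g₁ , g₂ , _) , gρ) → (g₁ , gρ) , (g₂ , gρ) , NotSingleton-heads p s λ ())
      (λ ((g₁ , gρ) , (g₂ , _) , _) →
         (g₁ , g₂ , Admissible-premise-NotSingleton adm p q r (head-∈ s)) , gρ)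
IdLike-⇝ adm (⊗&₂ _ _ _ _ _ _ {w₁ = _ , _ , p , _ , q} {w₂ = _ , r , _} {w₃ = _ , s , _}) =
  mk⇔ (λ (gρ , (g₁ , g₂ , _)) → (gρ , g₁) , (gρ , g₂) , NotSingleton-heads p s λ ())
      (λ ((gρ , g₁) , (_ , g₂) , _) →
         gρ , (g₁ , g₂ , Admissible-premise-NotSingleton adm p q r (head-∈ s)))
IdLike-⇝ _ (&& A B a C D c {w₁} {w₂} {w₃} {w₄} {w₅} {w₆} {π₁₁} {π₁₂} {π₂₁} {π₂₂}) =
  mk⇔ (IdLike-&& A B a C D c w₁ w₂ w₃ w₄ w₅ w₆ π₁₁ π₁₂ π₂₁ π₂₂)
      (IdLike-&& C D c A B a w₄ w₅ w₆ w₁ w₂ w₃ π₁₁ π₂₁ π₁₂ π₂₂)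
IdLike-⇝ adm (u⊤ d a {w₁} {w₂} {w₃}) = IdLike-u⊤ d a w₁ w₂ w₃ adm
IdLike-⇝ adm (⊗⊤ₗ _ _ _ _ {w₁ = w₁@(_ , _ , p , _)} {w₃ = w}) =
  absurd⇔ (¬TopPair-⊗-premiseˡ adm w w₁ ∘ proj₁) (flip TopPair-head p)
IdLike-⇝ adm (⊗⊤ᵣ _ _ _ _ {w₁ = w₁@(_ , _ , p , _)} {w₃ = w}) =
  absurd⇔ (¬TopPair-⊗-premiseʳ adm w w₁ ∘ proj₂) (flip TopPair-head p)
IdLike-⇝ adm (&⊤ _ _ _ _ {w₁ = w₁@(_ , p , _)} {w₄ = w}) =
  absurd⇔ (λ (g₁ , g₂ , _) → ¬TopPair-&-premises adm w w₁ g₁ g₂) (flip TopPair-head p)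
IdLike-⇝ _ (⊤⊤ _ _ {w₁} {w₂}) = mk⇔ (flip TopPair-move w₂) (flip TopPair-move w₁)
IdLike-⇝ _ (in-u (bot _) st) =
  mk⇔ (λ (F , p , q , ch) → F , p , q , OneChain-⇝ ch st)
      (λ (F , p , q , ch) → F , p , q , OneChain-⇜ ch st)
IdLike-⇝ adm (in-u d@(par _ _ _) {w} st) = IdLike-⇝ (Admissible-unary d adm w) st
IdLike-⇝ adm (in-u d@(plus1 _ _ _) {w} st) = IdLike-⇝ (Admissible-unary d adm w) st
IdLike-⇝ adm (in-u d@(plus2 _ _ _) {w} st) = IdLike-⇝ (Admissible-unary d adm w) st
IdLike-⇝ adm (in-⊗ₗ _ _ _ {w} st) = IdLike-⇝ (proj₁ (Admissible-tensor adm w)) st ×-⇔ ⇔-id _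
IdLike-⇝ adm (in-⊗ᵣ _ _ _ {w} st) = ⇔-id _ ×-⇔ IdLike-⇝ (proj₂ (Admissible-tensor adm w)) st
IdLike-⇝ adm (in-&ₗ _ _ _ {w} st) = IdLike-⇝ (proj₁ (Admissible-amp adm w)) st ×-⇔ ⇔-id _
IdLike-⇝ adm (in-&ᵣ _ _ _ {w} st) = ⇔-id _ ×-⇔ IdLike-⇝ (proj₂ (Admissible-amp adm w)) st ×-⇔ ⇔-id _

CommStep⇒↭ : ∀ {x y} → CommStep x y → proj₁ x ↭ proj₁ y
CommStep⇒↭ (fwd _) = ↭-refl
CommStep⇒↭ (bwd _) = ↭-refl
CommStep⇒↭ (exch i) = ≅⇒↭ i

≡ᶜ⇒↭ : ∀ {x y} → x ≡ᶜ y → proj₁ x ↭ proj₁ y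
≡ᶜ⇒↭ = fold (λ x y → proj₁ x ↭ proj₁ y) (↭-trans ∘ CommStep⇒↭) ↭-refl

IdLike-CommStep : ∀ {x y} → Admissible (proj₁ x) → CommStep x y → IdLike (proj₂ y) → IdLike (proj₂ x)
IdLike-CommStep adm (fwd st) = Equivalence.from (IdLike-⇝ adm st)
IdLike-CommStep adm (bwd st) = Equivalence.to (IdLike-⇝ adm st)
IdLike-CommStep adm (exch i) = IdLike-≅ (≅-sym i)

IdLike-≡ᶜ : ∀ {x y} → Admissible (proj₁ x) → x ≡ᶜ y → IdLike (proj₂ y) → IdLike (proj₂ x)
IdLike-≡ᶜ adm ε g = g
IdLike-≡ᶜ adm (s ◅ ss) g =
  IdLike-CommStep adm s (IdLike-≡ᶜ (Admissible-resp-↭ (CommStep⇒↭ s) adm) ss g)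

proposition5p8 : (A : Formula) → Distributed A →
    ∀ {Γ} (π : Proof Γ) → (Γ , π) ≡ᶜ (_ , idProof A) →
    TopRulesOK π × BotRulesOK π × OneRulesOK π × NoWithSequent π
proposition5p8 A dist π π≡id =
  IdLike⇒TopRulesOK idLike , IdLike⇒BotRulesOK idLike , IdLike⇒OneRulesOK idLike ,
  IdLike⇒NoWithSequent idLike
  where
  idLike : IdLike π
  idLike = IdLike-≡ᶜ (Admissible-resp-↭ (↭-sym (≡ᶜ⇒↭ π≡id)) (Admissible-id dist)) π≡id
                     (IdLike-idp A (inA , []))
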